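{- For all integers $N\ge 2$ and $k$ with $0<k<N$, \[ \theta(J(N,k)) \le \binom{N-2}{k-1}. \]
   Context: For integers $0<k<N$, let $[N]=\{1,\dots,N\}$ and let $\mathcal{P}_k([N])$ be the set of $k$-element subsets of $[N]$. The Johnson graph $J(N,k)$ has vertex set $\mathcal{P}_k([N])$, two vertices $S_1,S_2$ being adjacent iff $|S_1\cap S_2| = k-1$. A (vertex) clique cover of a graph $G$ is a collection of cliques of $G$ whose vertex sets together contain every vertex of $G$; $\theta(G)$ denotes the smallest cardinality of a clique cover of $G$. -}

module Defs where

open import Data.Nat using (ℕ; _∸_)
open import Data.Fin.Subset using (Subset; ∣_∣; _∩_)
open import Data.List using (List; length)
open import Data.List.Membership.Propositional using (_∈_)
open import Data.List.Relation.Unary.Any using (Any)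
open import Data.Product using (_×_)
open import Relation.Binary.PropositionalEquality using (_≡_; _≢_)

-- Vertices of J(N,k): k-element subsets of [N] (here Fin N).
IsVertex : (N k : ℕ) → Subset N → Set
IsVertex N k S = ∣ S ∣ ≡ k

Adjacent : (N k : ℕ) → Subset N → Subset N → Set
Adjacent N k S₁ S₂ = ∣ S₁ ∩ S₂ ∣ ≡ k ∸ 1

IsClique : (N k : ℕ) → List (Subset N) → Set
IsClique N k C =
  (∀ {S} → S ∈ C → IsVertex N k S) ×
  (∀ {S T} → S ∈ C → T ∈ C → S ≢ T → Adjacent N k S T)

IsCliqueCover : (N k : ℕ) → List (List (Subset N)) → Set
IsCliqueCover N k 𝒞 =
  (∀ {C} → C ∈ 𝒞 → IsClique N k C) ×
  (∀ (S : Subset N) → IsVertex N k S → Any (λ C → S ∈ C) 𝒞)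

module Submission where

open import Defs
open import Data.Nat using (ℕ; zero; suc; _+_; _≤_; _<_; _∸_; z≤n; s≤s)
open import Data.Nat.Properties using (suc-injective; m≤n⇒m<n∨m≡n; <⇒≤; ≤-reflexive; +-mono-≤; +-comm; ≤-trans; module ≤-Reasoning)
open import Data.Nat.Combinatorics using (_C_; nCn≡1; nCk+nC[k+1]≡[n+1]C[k+1])
open import Data.Fin.Subset using (Subset; _∩_; ∣_∣; ⊥; ⊤; inside; outside)
open import Data.Fin.Subset.Properties using (∣⊥∣≡0; ∣⊤∣≡n; ∣p∣≡n⇒p≡⊤; ∩-zeroˡ; ∩-zeroʳ; ∩-identityˡ; ∩-identityʳ)
open import Data.Vec using (_∷_; [])
open import Data.Vec.Properties using (∷-injectiveʳ)
open import Data.List using (List; _∷_; []; [_]; length; map; _++_)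
open import Data.List.Properties using (length-map; length-++)
open import Data.List.Membership.Propositional using (_∈_)
open import Data.List.Membership.Propositional.Properties using (∈-map⁺; ∈-map⁻; ∈-++⁻)
open import Data.List.Relation.Unary.Any using (Any; here; there)
import Data.List.Relation.Unary.Any as Any
open import Data.List.Relation.Unary.Any.Properties using (map⁺; ++⁺ˡ; ++⁺ʳ)
open import Data.Product using (Σ; _×_; _,_)
open import Function using (id; _∘_)
open import Data.Sum using (inj₁; inj₂)
open import Relation.Nullary using (contradiction)
open import Relation.Binary.PropositionalEquality using (_≡_; _≢_; refl; sym; trans; cong; cong₂)

-- Split the vertices of J(n+1,k) by whether they contain the first point:
-- those that do not form a copy of J(n,k), those that do a copy of J(n,k-1),
-- and cliques of either copy stay cliques.  Hence θ(J(n+1,k)) ≤ θ(J(n,k)) + θ(J(n,k-1)),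
-- which is Pascal's rule for the bound.  The recursion bottoms out at k = 1, where all
-- singletons form one clique, and at k = n-1, where all complements of singletons do.

CoverWithin : (N k b : ℕ) → Set
CoverWithin N k b = Σ (List (List (Subset N))) (λ 𝒞 → IsCliqueCover N k 𝒞 × length 𝒞 ≤ b)

CoverWithin-≤ : ∀ {N k a b} → a ≤ b → CoverWithin N k a → CoverWithin N k b
CoverWithin-≤ a≤b (𝒞 , cover , 𝒞≤a) = 𝒞 , cover , ≤-trans 𝒞≤a a≤b

map-clique : ∀ {n m k l C} (f : Subset n → Subset m) →
  (∀ {S T} → f S ≡ f T → S ≡ T) →
  (∀ {S} → IsVertex n k S → IsVertex m l (f S)) →
  (∀ {S T} → Adjacent n k S T → Adjacent m l (f S) (f T)) →
  IsClique n k C → IsClique m l (map f C)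
map-clique {m = m} {l = l} {C = C} f f-injective f-vertex f-adjacent (vertex , adjacent) = vertex′ , adjacent′
  where
  vertex′ : ∀ {S} → S ∈ map f C → IsVertex m l S
  vertex′ S∈ with ∈-map⁻ f S∈
  ... | _ , S′∈ , refl = f-vertex (vertex S′∈)
  adjacent′ : ∀ {S T} → S ∈ map f C → T ∈ map f C → S ≢ T → Adjacent m l S T
  adjacent′ S∈ T∈ S≢T with ∈-map⁻ f S∈ | ∈-map⁻ f T∈
  ... | _ , S′∈ , refl | _ , T′∈ , refl = f-adjacent (adjacent S′∈ T′∈ (λ eq → S≢T (cong f eq)))

outside-clique : ∀ {n k C} → IsClique n k C → IsClique (suc n) k (map (outside ∷_) C)
outside-clique = map-clique (outside ∷_) ∷-injectiveʳ id id

-- Needs k ≥ 1: adjacency in J(n,k+1) means |S ∩ T| = k, which lifts to k + 1 = (k + 2) ∸ 1.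
inside-clique : ∀ {n k C} → IsClique n (suc k) C → IsClique (suc n) (suc (suc k)) (map (inside ∷_) C)
inside-clique = map-clique (inside ∷_) ∷-injectiveʳ (cong suc) (cong suc)

single-clique-cover : ∀ {N k C} → IsClique N k C → (∀ S → IsVertex N k S → S ∈ C) →
  CoverWithin N k 1
single-clique-cover {C = C} clique complete = [ C ] , (clique-of , λ S S-vertex → here (complete S S-vertex)) , s≤s z≤n
  where
  clique-of : ∀ {D} → D ∈ [ C ] → IsClique _ _ D
  clique-of (here refl) = clique

pascal-cover : ∀ {n k a b} → CoverWithin n (suc (suc k)) a → CoverWithin n (suc k) b →
  CoverWithin (suc n) (suc (suc k)) (a + b)
pascal-cover {n} {k} (A , (A-cliques , A-covers) , A≤a) (B , (B-cliques , B-covers) , B≤b) =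
  𝒞 , (cliques , covers) , size
  where
  𝒞 : List (List (Subset (suc n)))
  𝒞 = map (map (outside ∷_)) A ++ map (map (inside ∷_)) B
  cliques : ∀ {C} → C ∈ 𝒞 → IsClique (suc n) (suc (suc k)) C
  cliques C∈ with ∈-++⁻ (map (map (outside ∷_)) A) C∈
  ... | inj₁ C∈A with ∈-map⁻ _ C∈A
  ...   | _ , C′∈ , refl = outside-clique (A-cliques C′∈)
  cliques C∈ | inj₂ C∈B with ∈-map⁻ _ C∈B
  ...   | _ , C′∈ , refl = inside-clique (B-cliques C′∈)
  covers : ∀ S → IsVertex (suc n) (suc (suc k)) S → Any (S ∈_) 𝒞
  covers (outside ∷ S) S-vertex =
    ++⁺ˡ (map⁺ (Any.map (∈-map⁺ (outside ∷_)) (A-covers S S-vertex)))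
  covers (inside ∷ S) S-vertex =
    ++⁺ʳ (map (map (outside ∷_)) A) (map⁺ (Any.map (∈-map⁺ (inside ∷_)) (B-covers S (suc-injective S-vertex))))
  size : length 𝒞 ≤ _
  size = begin
    length 𝒞                                              ≡⟨ length-++ (map (map (outside ∷_)) A) ⟩
    length (map (map (outside ∷_)) A) + length (map (map (inside ∷_)) B)
      ≡⟨ cong₂ _+_ (length-map (map (outside ∷_)) A) (length-map (map (inside ∷_)) B) ⟩
    length A + length B                                   ≤⟨ +-mono-≤ A≤a B≤b ⟩
    _                                                     ∎
    where open ≤-Reasoning

singletons : ∀ n → List (Subset n)
singletons zero = []
singletons (suc n) = (inside ∷ ⊥) ∷ map (outside ∷_) (singletons n)

singleton-size : ∀ {n S} → S ∈ singletons n → ∣ S ∣ ≡ 1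
singleton-size {suc n} (here refl) = cong suc (∣⊥∣≡0 n)
singleton-size {suc _} (there S∈) with ∈-map⁻ _ S∈
... | _ , S′∈ , refl = singleton-size S′∈

singletons-disjoint : ∀ {n S T} → S ∈ singletons n → T ∈ singletons n → S ≢ T → ∣ S ∩ T ∣ ≡ 0
singletons-disjoint {suc _} (here refl) (here refl) S≢T = contradiction refl S≢T
singletons-disjoint {suc n} (here refl) (there T∈) _ with ∈-map⁻ _ T∈
... | T , _ , refl = trans (cong ∣_∣ (∩-zeroˡ T)) (∣⊥∣≡0 n)
singletons-disjoint {suc n} (there S∈) (here refl) _ with ∈-map⁻ _ S∈
... | S , _ , refl = trans (cong ∣_∣ (∩-zeroʳ S)) (∣⊥∣≡0 n)
singletons-disjoint {suc _} (there S∈) (there T∈) S≢T with ∈-map⁻ _ S∈ | ∈-map⁻ _ T∈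
... | _ , S′∈ , refl | _ , T′∈ , refl = singletons-disjoint S′∈ T′∈ (λ eq → S≢T (cong (outside ∷_) eq))

∣p∣≡0⇒p≡⊥ : ∀ {n} (p : Subset n) → ∣ p ∣ ≡ 0 → p ≡ ⊥
∣p∣≡0⇒p≡⊥ [] _ = refl
∣p∣≡0⇒p≡⊥ (outside ∷ p) ∣p∣≡0 = cong (outside ∷_) (∣p∣≡0⇒p≡⊥ p ∣p∣≡0)

∣S∣≡1⇒S∈singletons : ∀ {n} (S : Subset n) → ∣ S ∣ ≡ 1 → S ∈ singletons n
∣S∣≡1⇒S∈singletons (outside ∷ S) ∣S∣≡1 = there (∈-map⁺ (outside ∷_) (∣S∣≡1⇒S∈singletons S ∣S∣≡1))
∣S∣≡1⇒S∈singletons (inside ∷ S) ∣S∣≡1 = here (cong (inside ∷_) (∣p∣≡0⇒p≡⊥ S (suc-injective ∣S∣≡1)))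

singletons-cover : ∀ n → CoverWithin n 1 1
singletons-cover n = single-clique-cover (singleton-size , singletons-disjoint) ∣S∣≡1⇒S∈singletons

-- Sizes are stated as n = 1 + ∣ S ∣ and n = 2 + ∣ S ∩ T ∣ to avoid truncated subtraction.
cosingletons : ∀ n → List (Subset n)
cosingletons zero = []
cosingletons (suc n) = (outside ∷ ⊤) ∷ map (inside ∷_) (cosingletons n)

cosingleton-size : ∀ {n S} → S ∈ cosingletons n → suc ∣ S ∣ ≡ n
cosingleton-size {suc n} (here refl) = cong suc (∣⊤∣≡n n)
cosingleton-size {suc _} (there S∈) with ∈-map⁻ _ S∈
... | _ , S′∈ , refl = cong suc (cosingleton-size S′∈)

cosingletons-adjacent : ∀ {n S T} → S ∈ cosingletons n → T ∈ cosingletons n → S ≢ T →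
  suc (suc ∣ S ∩ T ∣) ≡ n
cosingletons-adjacent {suc _} (here refl) (here refl) S≢T = contradiction refl S≢T
cosingletons-adjacent {suc _} (here refl) (there T∈) _ with ∈-map⁻ _ T∈
... | T , T′∈ , refl = cong suc (trans (cong (suc ∘ ∣_∣) (∩-identityˡ T)) (cosingleton-size T′∈))
cosingletons-adjacent {suc _} (there S∈) (here refl) _ with ∈-map⁻ _ S∈
... | S , S′∈ , refl = cong suc (trans (cong (suc ∘ ∣_∣) (∩-identityʳ S)) (cosingleton-size S′∈))
cosingletons-adjacent {suc _} (there S∈) (there T∈) S≢T with ∈-map⁻ _ S∈ | ∈-map⁻ _ T∈
... | _ , S′∈ , refl | _ , T′∈ , refl =
  cong suc (cosingletons-adjacent S′∈ T′∈ (λ eq → S≢T (cong (inside ∷_) eq)))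

1+∣S∣≡n⇒S∈cosingletons : ∀ {n} (S : Subset n) → suc ∣ S ∣ ≡ n → S ∈ cosingletons n
1+∣S∣≡n⇒S∈cosingletons (outside ∷ S) 1+∣S∣≡n = here (cong (outside ∷_) (∣p∣≡n⇒p≡⊤ (suc-injective 1+∣S∣≡n)))
1+∣S∣≡n⇒S∈cosingletons (inside ∷ S) 1+∣S∣≡n =
  there (∈-map⁺ (inside ∷_) (1+∣S∣≡n⇒S∈cosingletons S (suc-injective 1+∣S∣≡n)))

cosingletons-cover : ∀ n → CoverWithin (suc (suc n)) (suc n) 1
cosingletons-cover n = single-clique-cover
  ((λ S∈ → suc-injective (cosingleton-size S∈)) ,
   (λ S∈ T∈ S≢T → suc-injective (suc-injective (cosingletons-adjacent S∈ T∈ S≢T))))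
  (λ S S-vertex → 1+∣S∣≡n⇒S∈cosingletons S (cong suc S-vertex))

binomial-cover : ∀ m j → j ≤ m → CoverWithin (suc (suc m)) (suc j) (m C j)
binomial-cover m zero _ = singletons-cover (suc (suc m))
binomial-cover zero (suc j) ()
binomial-cover (suc m) (suc j) (s≤s j≤m) with m≤n⇒m<n∨m≡n j≤m
... | inj₂ refl = CoverWithin-≤ (≤-reflexive (sym (nCn≡1 (suc m)))) (cosingletons-cover (suc m))
... | inj₁ j<m  = CoverWithin-≤ (≤-reflexive pascal)
                    (pascal-cover (binomial-cover m (suc j) j<m) (binomial-cover m j (<⇒≤ j<m)))
  where
  pascal : m C suc j + m C j ≡ suc m C suc j
  pascal = trans (+-comm (m C suc j) (m C j)) (nCk+nC[k+1]≡[n+1]C[k+1] m j)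

theorem3p2 : (N k : ℕ) → 2 ≤ N → 0 < k → k < N →
    Σ (List (List (Subset N))) (λ 𝒞 → IsCliqueCover N k 𝒞 × length 𝒞 ≤ (N ∸ 2) C (k ∸ 1))
theorem3p2 (suc (suc m)) (suc j) _ _ (s≤s (s≤s j≤m)) = binomial-cover m j j≤m
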